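{- Let $w$ be a string, $c$ a positive integer, and $a$ a maximally non-periodic substring of $w$ with parameter $c$. Then for every length $L\ge8c$, any $c+1$ contiguous substrings of $a$ of length $L$ starting at $c+1$ consecutive positions of $a$ are pairwise distinct.
   Context: A string $u$ is $p$-periodic if $u_i=u_{i+p}$ for all $1\le i\le|u|-p$; its minimum period is the least such $p\ge1$. A contiguous substring $a$ of $w$ is a maximally periodic substring with parameter $c$ if $|a|\ge8c$, $a$ has minimum period at most $c$, and extending $a$ by one letter on either side yields a string with minimum period greater than $c$. A contiguous substring of $w$ is a maximally non-periodic substring with parameter $c$ if it is a maximal contiguous substring of $w$ that does not intersect any maximally periodic substring with parameter $c$. -}

module Defs where

open import Data.Nat using (ℕ; zero; suc; _+_; _∸_; _*_; _≤_; _<_)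
open import Data.Fin using (Fin; toℕ)
open import Data.List using (List; length; take; drop; lookup)
open import Data.Product using (Σ; ∃; _×_; _,_)
open import Relation.Binary.PropositionalEquality using (_≡_)
open import Relation.Nullary using (¬_)

-- Strings over an alphabet A are lists; positions are 0-indexed.
-- The substring of u occupying positions i, i+1, ..., j-1 (interval [i,j)).
sub : {A : Set} → List A → ℕ → ℕ → List A
sub u i j = take (j ∸ i) (drop i u)

Periodic : {A : Set} → ℕ → List A → Set
Periodic p u = (i j : Fin (length u)) → toℕ j ≡ toℕ i + p → lookup u i ≡ lookup u j

MinPeriod≤ : {A : Set} → ℕ → List A → Set
MinPeriod≤ c u = ∃ λ p → 1 ≤ p × p ≤ c × Periodic p u

-- The interval [i,j) of w (i ≤ j ≤ |w|) is a maximally periodic substring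
-- with parameter c.  Extension on a side is only required when possible
-- (i.e. not at the boundary of w).
MaxPeriodic : {A : Set} → ℕ → List A → ℕ → ℕ → Set
MaxPeriodic c w i j =
    i ≤ j × j ≤ length w
  × 8 * c ≤ j ∸ i
  × MinPeriod≤ c (sub w i j)
  × ((k : ℕ) → suc k ≡ i → ¬ MinPeriod≤ c (sub w k j))
  × (j < length w → ¬ MinPeriod≤ c (sub w i (suc j)))

Intersect : ℕ → ℕ → ℕ → ℕ → Set
Intersect i j k l = ∃ λ x → i ≤ x × x < j × k ≤ x × x < l

AvoidsMP : {A : Set} → ℕ → List A → ℕ → ℕ → Set
AvoidsMP c w i j = (k l : ℕ) → MaxPeriodic c w k l → ¬ Intersect i j k l

MaxNonPeriodic : {A : Set} → ℕ → List A → ℕ → ℕ → Set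
MaxNonPeriodic c w i j =
    i ≤ j × j ≤ length w
  × AvoidsMP c w i j
  × ((i' j' : ℕ) → i' ≤ i → j ≤ j' → j' ≤ length w → AvoidsMP c w i' j'
       → i' ≡ i × j' ≡ j)

module Submission where

-- Suppose two of the windows coincide, say those starting at
-- x = s + k₁ < y = s + k₂ inside a = w[i,j).  Then a[x, y + L) is
-- (y - x)-periodic with 1 ≤ y - x ≤ c and has length at least L ≥ 8c: it is
-- a periodic run of w.  A periodic run can be enlarged, first to the left
-- and then to the right, as long as its minimum period stays ≤ c; since w is
-- finite this ends in a maximally periodic substring.  That substring
-- contains position i + x of [i,j), contradicting the fact that a maximally
-- non-periodic substring meets no maximally periodic one.

open import Defs
open import Data.Nat using (ℕ; zero; suc; _+_; _*_; _∸_; _⊓_; _≤_; _<_; s≤s)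
open import Data.Nat.Properties
open import Data.List using (List; []; _∷_; length; take; drop; lookup)
open import Data.List.Properties using (length-take; take-take; take-drop; drop-drop)
open import Data.Maybe using (Maybe; just; nothing)
open import Data.Maybe.Properties using (just-injective)
open import Data.Fin using (Fin; toℕ; fromℕ<)
open import Data.Fin.Properties using (toℕ<n; toℕ-fromℕ<)
open import Data.Product using (_×_; _,_)
open import Data.Empty using (⊥)
open import Relation.Nullary using (¬_)
open import Relation.Binary.PropositionalEquality using (_≡_; _≢_; refl; sym; trans; cong; cong₂; subst; subst₂; module ≡-Reasoning)
open import Relation.Binary.Definitions using (tri<; tri≈; tri>)

module _ {A : Set} where

  -- Position t of u, if it exists.  Unlike `lookup` it takes a plain
  -- natural number, which keeps index arithmetic on substrings simple.
  at : List A → ℕ → Maybe A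
  at []       _       = nothing
  at (x ∷ xs) zero    = just x
  at (x ∷ xs) (suc n) = at xs n

  at-lookup : (u : List A) (i : Fin (length u)) → at u (toℕ i) ≡ just (lookup u i)
  at-lookup (x ∷ u) Fin.zero    = refl
  at-lookup (x ∷ u) (Fin.suc i) = at-lookup u i

  at-take : ∀ n (u : List A) t → t < n → at (take n u) t ≡ at u t
  at-take (suc n) []      t       _         = refl
  at-take (suc n) (x ∷ u) zero    _         = refl
  at-take (suc n) (x ∷ u) (suc t) (s≤s t<n) = at-take n u t t<n

  at-drop : ∀ k (u : List A) t → at (drop k u) t ≡ at u (k + t)
  at-drop zero    u       t = refl
  at-drop (suc k) []      t = refl
  at-drop (suc k) (x ∷ u) t = at-drop k u t

  at-sub : ∀ (w : List A) a b t → t < b ∸ a → at (sub w a b) t ≡ at w (a + t)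
  at-sub w a b t t<b∸a = trans (at-take (b ∸ a) (drop a w) t t<b∸a) (at-drop a w t)

  length-take≤ : ∀ n (u : List A) → length (take n u) ≤ n
  length-take≤ n u = subst (_≤ n) (sym (length-take n u)) (m⊓n≤m n (length u))

  length-take-mono : ∀ (u : List A) {m n} → m ≤ n → length (take m u) ≤ length (take n u)
  length-take-mono u {m} {n} m≤n = subst₂ _≤_ (sym (length-take m u)) (sym (length-take n u))
    (⊓-monoˡ-≤ (length u) m≤n)

  Periodicᵃ : ℕ → List A → Set
  Periodicᵃ p u = ∀ t → t + p < length u → at u t ≡ at u (t + p)

  periodicᵃ⇒periodic : ∀ p u → Periodicᵃ p u → Periodic p u
  periodicᵃ⇒periodic p u per i j j≡i+p = just-injective (begin
    just (lookup u i)  ≡⟨ sym (at-lookup u i) ⟩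
    at u (toℕ i)       ≡⟨ per (toℕ i) (subst (_< length u) j≡i+p (toℕ<n j)) ⟩
    at u (toℕ i + p)   ≡⟨ cong (at u) (sym j≡i+p) ⟩
    at u (toℕ j)       ≡⟨ at-lookup u j ⟩
    just (lookup u j)  ∎)
    where open ≡-Reasoning


  periodic⇒periodicᵃ : ∀ p u → Periodic p u → Periodicᵃ p u
  periodic⇒periodicᵃ p u per t t+p<∣u∣ = begin
    at u t                   ≡⟨ cong (at u) (sym (toℕ-fromℕ< t<∣u∣)) ⟩
    at u (toℕ i)             ≡⟨ at-lookup u i ⟩
    just (lookup u i)        ≡⟨ cong just (per i j (trans (toℕ-fromℕ< t+p<∣u∣) (cong (_+ p) (sym (toℕ-fromℕ< t<∣u∣))))) ⟩
    just (lookup u j)        ≡⟨ sym (at-lookup u j) ⟩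
    at u (toℕ j)             ≡⟨ cong (at u) (toℕ-fromℕ< t+p<∣u∣) ⟩
    at u (t + p)             ∎
    where
      open ≡-Reasoning
      t<∣u∣ = ≤-<-trans (m≤m+n t p) t+p<∣u∣
      i = fromℕ< t<∣u∣
      j = fromℕ< t+p<∣u∣

  periodic-take : ∀ p m n (u : List A) → m ≤ n → Periodic p (take n u) → Periodic p (take m u)
  periodic-take p m n u m≤n per = periodicᵃ⇒periodic p (take m u) λ t t+p<∣uₘ∣ →
    let t+p<m    = <-≤-trans t+p<∣uₘ∣ (length-take≤ m u)
        t<m      = ≤-<-trans (m≤m+n t p) t+p<m
        t+p<∣uₙ∣ = <-≤-trans t+p<∣uₘ∣ (length-take-mono u m≤n)
    in begin
    at (take m u) t        ≡⟨ at-take m u t t<m ⟩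
    at u t                 ≡⟨ sym (at-take n u t (<-≤-trans t<m m≤n)) ⟩
    at (take n u) t        ≡⟨ periodic⇒periodicᵃ p (take n u) per t t+p<∣uₙ∣ ⟩
    at (take n u) (t + p)  ≡⟨ at-take n u (t + p) (<-≤-trans t+p<m m≤n) ⟩
    at u (t + p)           ≡⟨ sym (at-take m u (t + p) t+p<m) ⟩
    at (take m u) (t + p)  ∎
    where open ≡-Reasoning

  minPeriod≤-shorten : ∀ c (w : List A) a b → MinPeriod≤ c (sub w a (suc b)) → MinPeriod≤ c (sub w a b)
  minPeriod≤-shorten c w a b (p , 1≤p , p≤c , per) =
    p , 1≤p , p≤c , periodic-take p (b ∸ a) (suc b ∸ a) (drop a w) (∸-monoˡ-≤ a (n≤1+n b)) per

  window-periodic : ∀ (v : List A) x y L → x ≤ y → sub v x (x + L) ≡ sub v y (y + L) →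
                    Periodic (y ∸ x) (sub v x (y + L))
  window-periodic v x y L x≤y windows≡ = periodicᵃ⇒periodic d (sub v x (y + L)) λ t t+d<∣u∣ →
    let t+d<d+L = <-≤-trans t+d<∣u∣ (subst (length (sub v x (y + L)) ≤_) (+-∸-comm L x≤y)
                                           (length-take≤ (y + L ∸ x) (drop x v)))
        t<L     = +-cancelˡ-< d t L (subst (_< d + L) (+-comm t d) t+d<d+L)
        t<y+L∸x = subst (t <_) (sym (+-∸-comm L x≤y)) (<-≤-trans t<L (m≤n+m L d))
    in begin
    at (sub v x (y + L)) t        ≡⟨ at-sub v x (y + L) t t<y+L∸x ⟩
    at v (x + t)                  ≡⟨ sym (at-sub v x (x + L) t (subst (t <_) (sym (m+n∸m≡n x L)) t<L)) ⟩
    at (sub v x (x + L)) t        ≡⟨ cong (λ u → at u t) windows≡ ⟩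
    at (sub v y (y + L)) t        ≡⟨ at-sub v y (y + L) t (subst (t <_) (sym (m+n∸m≡n y L)) t<L) ⟩
    at v (y + t)                  ≡⟨ cong (at v) (shift t) ⟩
    at v (x + (t + d))            ≡⟨ sym (at-sub v x (y + L) (t + d)
                                           (subst (t + d <_) (sym (+-∸-comm L x≤y)) t+d<d+L)) ⟩
    at (sub v x (y + L)) (t + d)  ∎
    where
      open ≡-Reasoning
      d = y ∸ x
      shift : ∀ t → y + t ≡ x + (t + d)
      shift t = begin
        y + t        ≡⟨ cong (_+ t) (sym (m+[n∸m]≡n x≤y)) ⟩
        x + d + t    ≡⟨ +-assoc x d t ⟩
        x + (d + t)  ≡⟨ cong (x +_) (+-comm d t) ⟩
        x + (t + d)  ∎

  sub-sub : ∀ (w : List A) i j a b → a ≤ b → b ≤ j ∸ i → sub (sub w i j) a b ≡ sub w (i + a) (i + b)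
  sub-sub w i j a b a≤b b≤j∸i = begin
    take (b ∸ a) (drop a (take (j ∸ i) (drop i w)))          ≡⟨ cong (λ n → take (b ∸ a) (drop a (take n (drop i w))))
                                                                     (sym (m+[n∸m]≡n (≤-trans a≤b b≤j∸i))) ⟩
    take (b ∸ a) (drop a (take (a + (j ∸ i ∸ a)) (drop i w))) ≡⟨ cong (take (b ∸ a)) (sym (take-drop (j ∸ i ∸ a) a (drop i w))) ⟩
    take (b ∸ a) (take (j ∸ i ∸ a) (drop a (drop i w)))      ≡⟨ take-take (b ∸ a) (j ∸ i ∸ a) (drop a (drop i w)) ⟩
    take ((b ∸ a) ⊓ (j ∸ i ∸ a)) (drop a (drop i w))        ≡⟨ cong₂ take (m≤n⇒m⊓n≡m (∸-monoˡ-≤ a b≤j∸i)) (drop-drop i a w) ⟩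
    take (b ∸ a) (drop (i + a) w)                            ≡⟨ cong (λ n → take n (drop (i + a) w)) (sym ([m+n]∸[m+o]≡n∸o i b a)) ⟩
    take (i + b ∸ (i + a)) (drop (i + a) w)                  ∎
    where open ≡-Reasoning

-- Periodic runs of w: the substrings w[a,b) of length ≥ 8c with minimum
-- period ≤ c.  A maximally periodic substring is a run that cannot be
-- enlarged by one letter on either side.
module Runs {A : Set} (c : ℕ) (w : List A) where

  Run : ℕ → ℕ → Set
  Run a b = a ≤ b × b ≤ length w × 8 * c ≤ b ∸ a × MinPeriod≤ c (sub w a b)

  LeftMaximal : ℕ → ℕ → Set
  LeftMaximal a b = (k : ℕ) → suc k ≡ a → ¬ MinPeriod≤ c (sub w k b)

  RightMaximal : ℕ → ℕ → Set
  RightMaximal a b = b < length w → ¬ MinPeriod≤ c (sub w a (suc b))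

  run-extendˡ : ∀ k b → Run (suc k) b → MinPeriod≤ c (sub w k b) → Run k b
  run-extendˡ k b (1+k≤b , b≤∣w∣ , long , _) periodic =
    ≤-trans (n≤1+n k) 1+k≤b , b≤∣w∣ , ≤-trans long (∸-monoʳ-≤ b (n≤1+n k)) , periodic

  run-extendʳ : ∀ a b → Run a b → b < length w → MinPeriod≤ c (sub w a (suc b)) → Run a (suc b)
  run-extendʳ a b (a≤b , _ , long , _) b<∣w∣ periodic =
    ≤-trans a≤b (n≤1+n b) , b<∣w∣ , ≤-trans long (∸-monoˡ-≤ a (n≤1+n b)) , periodic

  -- Enlarging on the right preserves left maximality, because shortening
  -- on the right preserves minimum period ≤ c.
  leftMaximal-extendʳ : ∀ a b → LeftMaximal a b → LeftMaximal a (suc b)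
  leftMaximal-extendʳ a b leftMax k 1+k≡a periodic = leftMax k 1+k≡a (minPeriod≤-shorten c w k b periodic)

  -- A position x of w lying in no maximally periodic substring lies in no run
  -- either: a run through x could be enlarged, first to the left and then to
  -- the right, into a maximally periodic substring through x.
  module _ (x : ℕ) (uncovered : ∀ k l → MaxPeriodic c w k l → k ≤ x → x < l → ⊥) where

    grow-right : ∀ n a b → n + b ≡ length w → Run a b → LeftMaximal a b → a ≤ x → x < b → ⊥
    grow-right n a b n+b≡∣w∣ run@(a≤b , b≤∣w∣ , long , periodic) leftMax a≤x x<b =
      uncovered a b (a≤b , b≤∣w∣ , long , periodic , leftMax , rightMax n n+b≡∣w∣) a≤x x<b
      where
        rightMax : ∀ n → n + b ≡ length w → RightMaximal a b
        rightMax zero    b≡∣w∣    b<∣w∣ _         = <-irrefl b≡∣w∣ b<∣w∣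
        rightMax (suc n) n+b≡∣w∣ b<∣w∣ periodic′ =
          grow-right n a (suc b) (trans (+-suc n b) n+b≡∣w∣) (run-extendʳ a b run b<∣w∣ periodic′)
            (leftMaximal-extendʳ a b leftMax) a≤x (<-≤-trans x<b (n≤1+n b))

    no-run-through : ∀ a b → Run a b → a ≤ x → x < b → ⊥
    no-run-through a b run@(_ , b≤∣w∣ , _) a≤x x<b =
      grow-right (length w ∸ b) a b (m∸n+n≡m b≤∣w∣) run (leftMax a run a≤x) a≤x x<b
      where
        leftMax : ∀ a → Run a b → a ≤ x → LeftMaximal a b
        leftMax (suc k) run 1+k≤x .k refl periodic =
          no-run-through k b (run-extendˡ k b run periodic) (≤-trans (n≤1+n k) 1+k≤x) x<b

-- Inside a maximally non-periodic substring w[i,j), two windows of length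
-- L ≥ 8c starting at distance between 1 and c are different: otherwise they
-- span a run of w through position i + s + k₁.
windows-differ : {A : Set} (w : List A) (c : ℕ) (i j : ℕ) → MaxNonPeriodic c w i j →
  (L : ℕ) → 8 * c ≤ L → (s : ℕ) → s + c + L ≤ length (sub w i j) →
  (k₁ k₂ : ℕ) → k₁ < k₂ → k₂ ≤ c →
  sub (sub w i j) (s + k₁) (s + k₁ + L) ≢ sub (sub w i j) (s + k₂) (s + k₂ + L)
windows-differ w c i j (i≤j , j≤∣w∣ , avoids , _) L 8c≤L s fits k₁ k₂ k₁<k₂ k₂≤c windows≡ =
  no-run-through (i + x) uncovered (i + x) (i + (y + L)) run ≤-refl (+-monoʳ-< i x<y+L)
  where
    open Runs c w
    x = s + k₁
    y = s + k₂
    x≤y : x ≤ y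
    x≤y = +-monoʳ-≤ s (<⇒≤ k₁<k₂)
    x<y+L : x < y + L
    x<y+L = <-≤-trans (+-monoʳ-< s k₁<k₂) (m≤m+n y L)
    y+L≤j∸i : y + L ≤ j ∸ i
    y+L≤j∸i = ≤-trans (+-monoˡ-≤ L (+-monoʳ-≤ s k₂≤c)) (≤-trans fits (length-take≤ (j ∸ i) (drop i w)))
    i+[y+L]≤j : i + (y + L) ≤ j
    i+[y+L]≤j = subst (i + (y + L) ≤_) (m+[n∸m]≡n i≤j) (+-monoʳ-≤ i y+L≤j∸i)
    period : y ∸ x ≡ k₂ ∸ k₁
    period = [m+n]∸[m+o]≡n∸o s k₂ k₁
    periodic : MinPeriod≤ c (sub w (i + x) (i + (y + L)))
    periodic = k₂ ∸ k₁ , m<n⇒0<n∸m k₁<k₂ , ≤-trans (m∸n≤m k₂ k₁) k₂≤c ,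
      subst₂ Periodic period (sub-sub w i j x (y + L) (<⇒≤ x<y+L) y+L≤j∸i)
        (window-periodic (sub w i j) x y L x≤y windows≡)
    long : 8 * c ≤ i + (y + L) ∸ (i + x)
    long = ≤-trans 8c≤L (subst (L ≤_) (sym (trans ([m+n]∸[m+o]≡n∸o i (y + L) x) (+-∸-comm L x≤y)))
                                       (m≤n+m L (y ∸ x)))
    run : Run (i + x) (i + (y + L))
    run = +-monoʳ-≤ i (<⇒≤ x<y+L) , ≤-trans i+[y+L]≤j j≤∣w∣ , long , periodic
    uncovered : ∀ k l → MaxPeriodic c w k l → k ≤ i + x → i + x < l → ⊥
    uncovered k l maxPeriodic k≤i+x i+x<l =
      avoids k l maxPeriodic (i + x , m≤m+n i x , <-≤-trans (+-monoʳ-< i x<y+L) i+[y+L]≤j , k≤i+x , i+x<l)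

lemma47 : {A : Set} (w : List A) (c : ℕ) → 1 ≤ c → (i j : ℕ) → MaxNonPeriodic c w i j →
    (L : ℕ) → 8 * c ≤ L → (s : ℕ) → s + c + L ≤ length (sub w i j) →
    (k₁ k₂ : ℕ) → k₁ ≤ c → k₂ ≤ c → k₁ ≢ k₂ →
    sub (sub w i j) (s + k₁) (s + k₁ + L) ≢ sub (sub w i j) (s + k₂) (s + k₂ + L)
lemma47 w c _ i j maxNonPeriodic L 8c≤L s fits k₁ k₂ k₁≤c k₂≤c k₁≢k₂ windows≡ with <-cmp k₁ k₂
... | tri< k₁<k₂ _ _ = windows-differ w c i j maxNonPeriodic L 8c≤L s fits k₁ k₂ k₁<k₂ k₂≤c windows≡
... | tri≈ _ k₁≡k₂ _ = k₁≢k₂ k₁≡k₂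
... | tri> _ _ k₂<k₁ = windows-differ w c i j maxNonPeriodic L 8c≤L s fits k₂ k₁ k₂<k₁ k₁≤c (sym windows≡)
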